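{- Let $\Sigma_V,\Sigma_E$ be label sets and $\alpha:\Sigma_V\cup\Sigma_E\to(0,+\infty)$. Let $G$ be the set of graphs with vertex labels in $\Sigma_V$ and edge labels in $\Sigma_E$, where isomorphic graphs are regarded as the same element of $G$. Let $\subseteq$ be the subgraph-isomorphic relation on $G$, and define $s_{GVE\alpha}:G\to[0,\infty)$ by $s_{GVE\alpha}(g)=0$ if $V=\emptyset$ and otherwise $s_{GVE\alpha}(g)=\sum_{v\in V}\alpha(\ell_V(v))+\sum_{e\in E}\alpha(\ell_E(e))$ for $g=(V,E,\ell_V,\ell_E)$. Then $(G,\subseteq,s_{GVE\alpha})$ is a Maximum Common Subelement (MCS) Model.
   Context: A graph is a 4-tuple $g=(V,E,\ell_V,\ell_E)$ with $V$ a finite set, $E\subseteq[V]^2$ (the set of 2-element subsets of $V$), $\ell_V:V\to\Sigma_V$, $\ell_E:E\to\Sigma_E$; it is empty if $V=\emptyset$. $g'=(V',E',\ell'_V,\ell'_E)$ is a subgraph of $g$ if $V'\subseteq V$, $E'\subseteq E\cap[V']^2$, and $\ell'_V,\ell'_E$ agree with $\ell_V,\ell_E$ on $V',E'$. An isomorphism between $g_1$ and $g_2$ is a bijection $\phi:V_1\to V_2$ with $E_2=\{\{\phi(u),\phi(v)\}:\{u,v\}\in E_1\}$ preserving vertex and edge labels. $g'\subseteq g$ means some subgraph of $g$ is isomorphic to $g'$. For a partial order $\preccurlyeq$ on $X$ and $X'\subseteq X$, $cs(X')=\{x\in X: x\preccurlyeq y\ \forall y\in X'\}$. A size function on $(X,\preccurlyeq)$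 is $s:X\to[0,\infty)$ with (S1) $x_1\preccurlyeq x_2\Rightarrow s(x_1)\le s(x_2)$ and (S2) $x_1\preccurlyeq x_2$, $s(x_1)=s(x_2)\Rightarrow x_1=x_2$. An MCS Model is a triple $(X,\preccurlyeq,s)$ with $\preccurlyeq$ a partial order on $X$, $s$ a size function, and (A1) for all $x_1,x_2$, $cs(\{x_1,x_2\})\ne\emptyset$ and $\{s(x)\mid x\in cs(\{x_1,x_2\})\}$ has a maximum; (A2) for all $x_1,x_2,x$ with $x_1,x_2\preccurlyeq x$ there is $x_{12}\in cs(\{x_1,x_2\})$ with $s(x)\ge s(x_1)+s(x_2)-s(x_{12})$. -}

module Defs where

open import Level using (0ℓ)
open import Data.Nat using (ℕ) renaming (zero to nzero; suc to nsuc)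
open import Data.Fin using (Fin; _<?_) renaming (zero to fzero; suc to fsuc)
open import Data.Maybe using (Maybe; just; nothing)
open import Data.Sum using (_⊎_; inj₁; inj₂)
open import Data.Product using (Σ; ∃; _×_; _,_)
open import Data.Bool using (if_then_else_)
open import Relation.Nullary using (¬_; does)
open import Relation.Binary.Core using (Rel)
open import Relation.Binary.Structures using (IsTotalOrder; IsPartialOrder)
open import Relation.Binary.PropositionalEquality using (_≡_)
open import Algebra.Bundles using (CommutativeRing)
open import Function.Bundles using (_↔_; _↣_; Inverse; Injection)

-- The real numbers, axiomatised as a complete ordered field.
-- (Any two complete ordered fields are isomorphic, so quantifying over
-- all of them is the same as speaking about ℝ.)

record CompleteOrderedField : Set₁ where
  field
    commutativeRing : CommutativeRing 0ℓ 0ℓ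
  open CommutativeRing commutativeRing public
    using (Carrier; _≈_; _+_; _*_; -_; 0#; 1#)
  field
    _≤_           : Rel Carrier 0ℓ
    ≤-isTotalOrder : IsTotalOrder _≈_ _≤_
    +-monoˡ-≤     : ∀ {x y} z → x ≤ y → (x + z) ≤ (y + z)
    *-nonneg      : ∀ {x y} → 0# ≤ x → 0# ≤ y → 0# ≤ (x * y)
    0≉1           : ¬ (0# ≈ 1#)
    inverse       : ∀ x → ¬ (x ≈ 0#) → ∃ λ y → (x * y) ≈ 1#
    complete      : (P : Carrier → Set) → ∃ P →
                    (∃ λ b → ∀ x → P x → x ≤ b) →
                    ∃ λ u → (∀ x → P x → x ≤ u) ×
                            (∀ b → (∀ x → P x → x ≤ b) → u ≤ b)

  _<_ : Rel Carrier 0ℓ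
  x < y = (x ≤ y) × ¬ (x ≈ y)

  _−_ : Carrier → Carrier → Carrier
  x − y = x + (- y)

  sumFin : (n : ℕ) → (Fin n → Carrier) → Carrier
  sumFin nzero    f = 0#
  sumFin (nsuc n) f = f fzero + sumFin n (λ i → f (fsuc i))

-- MCS Models over a type X whose elements are identified up to an
-- equivalence _≈_ (the quotient is represented as a setoid).

module MCS (R : CompleteOrderedField) where
  open CompleteOrderedField R renaming (_≈_ to _≈ℝ_)

  record IsMCSModel (X : Set) (_≈_ : Rel X 0ℓ) (_≼_ : Rel X 0ℓ)
                    (s : X → Carrier) : Set where
    field
      isPartialOrder : IsPartialOrder _≈_ _≼_
      s-cong   : ∀ {x y} → x ≈ y → s x ≈ℝ s y
      s-nonneg : ∀ x → 0# ≤ s x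
      S1 : ∀ {x₁ x₂} → x₁ ≼ x₂ → s x₁ ≤ s x₂
      S2 : ∀ {x₁ x₂} → x₁ ≼ x₂ → s x₁ ≈ℝ s x₂ → x₁ ≈ x₂
      A1 : ∀ x₁ x₂ → ∃ λ x → (x ≼ x₁) × (x ≼ x₂) ×
                             (∀ y → y ≼ x₁ → y ≼ x₂ → s y ≤ s x)
      A2 : ∀ x₁ x₂ x → x₁ ≼ x → x₂ ≼ x →
           ∃ λ x₁₂ → (x₁₂ ≼ x₁) × (x₁₂ ≼ x₂) ×
                     (((s x₁ + s x₂) − s x₁₂) ≤ s x)

-- V = Fin n; the edge set together with its
-- labelling is encoded by a symmetric loop-free function
-- edge : V → V → Maybe ΣE  ({u,v} ∈ E with label l  iff  edge u v ≡ just l).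

record Graph (ΣV ΣE : Set) : Set where
  field
    n      : ℕ
    ℓV     : Fin n → ΣV
    edge   : Fin n → Fin n → Maybe ΣE
    sym    : ∀ u v → edge u v ≡ edge v u
    irrefl : ∀ v → edge v v ≡ nothing

module _ {ΣV ΣE : Set} where
  open Graph

  _≅_ : Rel (Graph ΣV ΣE) 0ℓ
  g₁ ≅ g₂ = Σ (Fin (n g₁) ↔ Fin (n g₂)) λ φ →
              (∀ v → ℓV g₂ (Inverse.to φ v) ≡ ℓV g₁ v) ×
              (∀ u v → edge g₂ (Inverse.to φ u) (Inverse.to φ v) ≡ edge g₁ u v)

  -- g' ⊆ g : some subgraph of g is isomorphic to g'
  -- (equivalently: an injective, label preserving map sending edges to edges)
  _⊆_ : Rel (Graph ΣV ΣE) 0ℓ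
  g' ⊆ g = Σ (Fin (n g') ↣ Fin (n g)) λ φ →
             (∀ v → ℓV g (Injection.to φ v) ≡ ℓV g' v) ×
             (∀ u v l → edge g' u v ≡ just l →
                        edge g (Injection.to φ u) (Injection.to φ v) ≡ just l)

module _ (R : CompleteOrderedField) {ΣV ΣE : Set} where
  open CompleteOrderedField R
  open Graph

  edgeWeight : (ΣV ⊎ ΣE → Carrier) → Maybe ΣE → Carrier
  edgeWeight α nothing  = 0#
  edgeWeight α (just l) = α (inj₂ l)

  sizeGVE : (ΣV ⊎ ΣE → Carrier) → Graph ΣV ΣE → Carrier
  sizeGVE α g with n g
  ... | nzero = 0#
  ... | nsuc _ =
    sumFin (n g) (λ v → α (inj₁ (ℓV g v)))
    + sumFin (n g) (λ u → sumFin (n g) (λ v →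
        if does (u <? v) then edgeWeight α (edge g u v) else 0#))

module Submission where

-- Doubling the size removes the asymmetric u < v of sizeGVE: 2 s(g) = 2 Σ_v α(ℓ v) + Σ_{u,v} α(ℓ {u,v}),
-- a sum over ordered pairs.  For an embedding φ : g′ ⊆ g, 2 s(g′) is the same sum over g with every
-- vertex and pair weight multiplied by the indicator of lying in the image of φ.  Then (S1) holds since
-- indicators are at most 1, (S2) since α is positive (equal sizes force every vertex and edge of g into
-- the image, so φ is an isomorphism), and (A2) by [A] + [B] ≤ 1 + [A ∧ B], taking for x₁₂ the
-- intersection of the images of x₁ and x₂ in x.  For (A1), every common subgraph of x₁ and x₂ is
-- isomorphic to one of the finitely many subgraphs of x₁ cut out by a choice of vertices and edges,
-- so a largest one exists.

open import Defs
open import Level using (0ℓ)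
open import Axiom.ExcludedMiddle using (ExcludedMiddle)
open import Algebra.Bundles using (CommutativeRing)
open import Data.Bool using (Bool; true; false; T; if_then_else_; _∧_)
open import Data.Bool.Properties using (T-∧; ∧-comm)
open import Data.Fin using (Fin; zero; suc; _<?_)
open import Data.Fin.Properties using (_≟_; any?; suc-injective; <-cmp)
open import Data.List using (List; []; _∷_; cartesianProduct; cartesianProductWith)
open import Data.List.Membership.Propositional using (_∈_)
open import Data.List.Membership.Propositional.Properties using (∈-cartesianProduct⁺; ∈-cartesianProductWith⁺)
open import Data.List.Relation.Unary.Any using (here; there)
open import Data.Maybe using (Maybe; just; nothing)
open import Data.Maybe.Properties using (just-injective)
open import Data.Nat using (ℕ)
open import Data.Product using (∃; ∃₂; _×_; _,_; proj₁; proj₂)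
open import Data.Sum using (_⊎_; inj₁; inj₂)
open import Data.Unit using (tt)
open import Data.Vec using (Vec; []; _∷_; lookup; tabulate)
open import Data.Vec.Properties using (lookup∘tabulate)
open import Function using (_∘_)
open import Function.Bundles using (Inverse; Injection; Equivalence; mk↔ₛ′)
open import Function.Construct.Composition using (_↔-∘_; _↣-∘_)
open import Function.Construct.Identity using (↔-id)
open import Function.Construct.Symmetry using (↔-sym)
open import Function.Definitions using (Injective)
open import Function.Properties.Inverse using (↔⇒↣)
open import Relation.Binary.Bundles using (Poset)
open import Relation.Binary.Definitions using (tri<; tri≈; tri>)
open import Relation.Binary.PropositionalEquality as ≡ using (_≡_; refl)
open import Relation.Binary.Structures using (IsTotalOrder; IsPartialOrder)
open import Relation.Nullary using (¬_; Dec; yes; no; does; contradiction)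
open import Relation.Nullary.Decidable using (isYes; toWitness; fromWitness)
open import Relation.Unary using (Pred; Decidable)

module OrderedFieldProperties (R : CompleteOrderedField) where
  open CompleteOrderedField R
  open CommutativeRing commutativeRing
    using (+-cong; +-congˡ; +-comm; +-identityˡ; +-identityʳ; -‿inverseʳ; +-assoc;
           +-commutativeMonoid; +-commutativeSemigroup)
    renaming (refl to ≈-refl; sym to ≈-sym; trans to ≈-trans; reflexive to ≈-reflexive) public
  open IsTotalOrder ≤-isTotalOrder
    using (isPartialOrder; total; antisym)
    renaming (refl to ≤-refl; reflexive to ≤-reflexive; trans to ≤-trans) public
  open import Algebra.Properties.CommutativeMonoid.Sum +-commutativeMonoid public
    using (sum; sum-cong-≋; sum-cong-≗; sum-replicate-zero; ∑-distrib-+; ∑-comm)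
  open import Algebra.Properties.CommutativeSemigroup +-commutativeSemigroup public
    using (interchange)

  poset : Poset 0ℓ 0ℓ 0ℓ
  poset = record { isPartialOrder = isPartialOrder }

  open import Relation.Binary.Reasoning.PartialOrder poset public

  +-mono-≤ : ∀ {a b c d} → a ≤ b → c ≤ d → (a + c) ≤ (b + d)
  +-mono-≤ {a} {b} {c} {d} a≤b c≤d = begin
    a + c  ≤⟨ +-monoˡ-≤ c a≤b ⟩
    b + c  ≈⟨ +-comm b c ⟩
    c + b  ≤⟨ +-monoˡ-≤ b c≤d ⟩
    d + b  ≈⟨ +-comm d b ⟩
    b + d  ∎

  +-cancelʳ-≤ : ∀ {a b} c → (a + c) ≤ (b + c) → a ≤ b
  +-cancelʳ-≤ {a} {b} c a+c≤b+c = begin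
    a              ≈⟨ x+c−c≈x a ⟨
    (a + c) + - c  ≤⟨ +-monoˡ-≤ (- c) a+c≤b+c ⟩
    (b + c) + - c  ≈⟨ x+c−c≈x b ⟩
    b              ∎
    where
    x+c−c≈x : ∀ x → ((x + c) + (- c)) ≈ x
    x+c−c≈x x = ≈-trans (+-assoc x c (- c)) (≈-trans (+-congˡ (-‿inverseʳ c)) (+-identityʳ x))

  x+x≤y+y⇒x≤y : ∀ {x y} → (x + x) ≤ (y + y) → x ≤ y
  x+x≤y+y⇒x≤y {x} {y} x+x≤y+y with total x y
  ... | inj₁ x≤y = x≤y
  ... | inj₂ y≤x = +-cancelʳ-≤ x (≤-trans x+x≤y+y (+-mono-≤ ≤-refl y≤x))

  +-mono-≤-tight : ∀ {a b c d} → a ≤ b → c ≤ d → (b + d) ≤ (a + c) → b ≤ a × d ≤ c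
  +-mono-≤-tight {a} {b} {c} {d} a≤b c≤d b+d≤a+c =
    +-cancelʳ-≤ d (≤-trans b+d≤a+c (+-mono-≤ ≤-refl c≤d)) ,
    +-cancelʳ-≤ b (begin
      d + b  ≈⟨ +-comm d b ⟩
      b + d  ≤⟨ b+d≤a+c ⟩
      a + c  ≤⟨ +-mono-≤ a≤b ≤-refl ⟩
      b + c  ≈⟨ +-comm b c ⟩
      c + b  ∎)

  x≤z+y⇒x−y≤z : ∀ {x y z} → x ≤ (z + y) → (x − y) ≤ z
  x≤z+y⇒x−y≤z {x} {y} {z} x≤z+y = +-cancelʳ-≤ y (begin
    (x + - y) + y  ≈⟨ +-assoc x (- y) y ⟩
    x + (- y + y)  ≈⟨ +-congˡ (≈-trans (+-comm (- y) y) (-‿inverseʳ y)) ⟩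
    x + 0#         ≈⟨ +-identityʳ x ⟩
    x              ≤⟨ x≤z+y ⟩
    z + y          ∎)

  <⇒≰ : ∀ {x y} → x < y → ¬ (y ≤ x)
  <⇒≰ (x≤y , x≉y) y≤x = x≉y (antisym x≤y y≤x)

  -- Stated with if/does so that the summands of sizeGVE are literally of this form.
  select : ∀ {A : Set} → Dec A → Carrier → Carrier
  select A? x = if does A? then x else 0#

  select-cong : ∀ {A B : Set} (A? : Dec A) (B? : Dec B) → (A → B) → (B → A) →
                ∀ x → select A? x ≈ select B? x
  select-cong (yes _) (yes _) _   _   x = ≈-refl
  select-cong (yes a) (no ¬b) A→B _   x = contradiction (A→B a) ¬b
  select-cong (no ¬a) (yes b) _   B→A x = contradiction (B→A b) ¬a
  select-cong (no _)  (no _)  _   _   x = ≈-refl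

  select-yes : ∀ {A : Set} (A? : Dec A) → A → ∀ x → select A? x ≈ x
  select-yes (yes _) _ x = ≈-refl
  select-yes (no ¬a) a x = contradiction a ¬a

  select-no : ∀ {A : Set} (A? : Dec A) → ¬ A → ∀ x → select A? x ≈ 0#
  select-no (yes a) ¬a x = contradiction a ¬a
  select-no (no _)  _  x = ≈-refl

  select-≤ : ∀ {A : Set} (A? : Dec A) {x} → 0# ≤ x → select A? x ≤ x
  select-≤ (yes _) _   = ≤-refl
  select-≤ (no _)  0≤x = 0≤x

  select-nonneg : ∀ {A : Set} (A? : Dec A) {x} → 0# ≤ x → 0# ≤ select A? x
  select-nonneg (yes _) 0≤x = 0≤x
  select-nonneg (no _)  _   = ≤-refl

  select-positive : ∀ {A : Set} (A? : Dec A) {x} → 0# < x → x ≤ select A? x → A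
  select-positive (yes a) _   _   = a
  select-positive (no _)  0<x x≤0 = contradiction x≤0 (<⇒≰ 0<x)

  select-inclusion–exclusion : ∀ {A B C : Set} (A? : Dec A) (B? : Dec B) (C? : Dec C) →
                               (A → B → C) → ∀ {x} → 0# ≤ x →
                               (select A? x + select B? x) ≤ (x + select C? x)
  select-inclusion–exclusion (yes a) (yes b) (yes _) _ _ = ≤-refl
  select-inclusion–exclusion (yes a) (yes b) (no ¬c) A→B→C _ = contradiction (A→B→C a b) ¬c
  select-inclusion–exclusion (yes _) (no _) C? _ {x} 0≤x = begin
    x + 0#          ≤⟨ +-mono-≤ ≤-refl (select-nonneg C? 0≤x) ⟩
    x + select C? x ∎
  select-inclusion–exclusion (no _) (yes _) C? _ {x} 0≤x = begin
    0# + x          ≈⟨ +-comm 0# x ⟩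
    x + 0#          ≤⟨ +-mono-≤ ≤-refl (select-nonneg C? 0≤x) ⟩
    x + select C? x ∎
  select-inclusion–exclusion (no _) (no _) C? _ 0≤x = +-mono-≤ 0≤x (select-nonneg C? 0≤x)

  sumFin≡sum : ∀ n (f : Fin n → Carrier) → sumFin n f ≡ sum f
  sumFin≡sum ℕ.zero    f = refl
  sumFin≡sum (ℕ.suc n) f = ≡.cong (f zero +_) (sumFin≡sum n (f ∘ suc))

  sum-mono-≤ : ∀ {n} {f g : Fin n → Carrier} → (∀ i → f i ≤ g i) → sum f ≤ sum g
  sum-mono-≤ {ℕ.zero}  f≤g = ≤-refl
  sum-mono-≤ {ℕ.suc n} f≤g = +-mono-≤ (f≤g zero) (sum-mono-≤ (f≤g ∘ suc))

  sum-mono-≤-tight : ∀ {n} {f g : Fin n → Carrier} → (∀ i → f i ≤ g i) → sum g ≤ sum f →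
                     ∀ i → g i ≤ f i
  sum-mono-≤-tight {ℕ.suc n} f≤g ∑g≤∑f i with +-mono-≤-tight (f≤g zero) (sum-mono-≤ (f≤g ∘ suc)) ∑g≤∑f
  sum-mono-≤-tight f≤g _ zero    | g₀≤f₀ , _    = g₀≤f₀
  sum-mono-≤-tight f≤g _ (suc i) | _ , ∑g′≤∑f′ = sum-mono-≤-tight (f≤g ∘ suc) ∑g′≤∑f′ i

  sum-+-mono-≤ : ∀ {n} {f g h k : Fin n → Carrier} → (∀ i → (f i + g i) ≤ (h i + k i)) →
                 (sum f + sum g) ≤ (sum h + sum k)
  sum-+-mono-≤ {f = f} {g} {h} {k} fg≤hk = begin
    sum f + sum g             ≈⟨ ∑-distrib-+ f g ⟨
    sum (λ i → f i + g i)     ≤⟨ sum-mono-≤ fg≤hk ⟩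
    sum (λ i → h i + k i)     ≈⟨ ∑-distrib-+ h k ⟩
    sum h + sum k             ∎

  sum² : ∀ {n} → (Fin n → Fin n → Carrier) → Carrier
  sum² e = sum (λ a → sum (e a))

  sum²-+-mono-≤ : ∀ {n} {e₁ e₂ e e₃ : Fin n → Fin n → Carrier} →
                  (∀ a c → (e₁ a c + e₂ a c) ≤ (e a c + e₃ a c)) → (sum² e₁ + sum² e₂) ≤ (sum² e + sum² e₃)
  sum²-+-mono-≤ {e₁ = e₁} {e₂} {e} {e₃} ee≤ee =
    sum-+-mono-≤ {f = sum ∘ e₁} {sum ∘ e₂} {sum ∘ e} {sum ∘ e₃} (λ a → sum-+-mono-≤ (ee≤ee a))

  sum-zero : ∀ {n} {f : Fin n → Carrier} → (∀ i → f i ≈ 0#) → sum f ≈ 0#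
  sum-zero {n} f≈0 = ≈-trans (sum-cong-≋ f≈0) (sum-replicate-zero n)

  sum-select-≟ : ∀ {n} (b : Fin n) (f : Fin n → Carrier) → sum (λ a → select (a ≟ b) (f a)) ≈ f b
  sum-select-≟ {ℕ.suc n} zero    f = ≈-trans (+-congˡ (sum-replicate-zero n)) (+-identityʳ (f zero))
  sum-select-≟ {ℕ.suc n} (suc b) f = ≈-trans (+-identityˡ _) (sum-select-≟ b (f ∘ suc))

  -- Double counting: Σᵤ f (φ u) = Σᵤ Σₐ [a = φ u] f a = Σₐ (Σᵤ [φ u = a]) f a, and the inner
  -- sum is 1 on the image of φ (by injectivity) and 0 elsewhere, where f vanishes.
  sum-∘-injective : ∀ {m n} {φ : Fin m → Fin n} → Injective _≡_ _≡_ φ → (f : Fin n → Carrier) →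
                    (∀ a → (∀ u → ¬ (φ u ≡ a)) → f a ≈ 0#) → sum (f ∘ φ) ≈ sum f
  sum-∘-injective {m} {n} {φ} φ-injective f f-vanishes = begin-equality
    sum (f ∘ φ)                                              ≈⟨ sum-cong-≋ (λ u → sum-select-≟ (φ u) f) ⟨
    sum (λ u → sum (λ a → select (a ≟ φ u) (f a)))          ≈⟨ ∑-comm (λ u a → select (a ≟ φ u) (f a)) ⟩
    sum (λ a → sum (λ u → select (a ≟ φ u) (f a)))          ≈⟨ sum-cong-≋ count ⟩
    sum f                                                    ∎
    where
    count : ∀ a → sum (λ u → select (a ≟ φ u) (f a)) ≈ f a
    count a with any? (λ u → φ u ≟ a)
    ... | yes (u₀ , refl) = ≈-trans
      (sum-cong-≋ (λ u → select-cong (φ u₀ ≟ φ u) (u ≟ u₀)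
                                     (≡.sym ∘ φ-injective) (≡.cong φ ∘ ≡.sym) (f (φ u₀))))
      (sum-select-≟ u₀ (λ _ → f (φ u₀)))
    ... | no ∄u = ≈-trans
      (sum-zero (λ u → select-no (a ≟ φ u) (∄u ∘ (u ,_) ∘ ≡.sym) (f a)))
      (≈-sym (f-vanishes a (λ u → ∄u ∘ (u ,_))))

  argmax : ∀ {A : Set} {S : Pred A 0ℓ} → Decidable S → (F : A → Carrier) → (xs : List A) →
           (∀ c → c ∈ xs → ¬ S c) ⊎ (∃ λ a → S a × (∀ c → c ∈ xs → S c → F c ≤ F a))
  argmax S? F []       = inj₁ (λ _ ())
  argmax S? F (x ∷ xs) with S? x | argmax S? F xs
  ... | no ¬Sx | inj₁ none = inj₁ λ where
    c (here refl) → ¬Sx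
    c (there c∈xs) → none c c∈xs
  ... | no ¬Sx | inj₂ (a , Sa , a-max) = inj₂ (a , Sa , λ where
    c (here refl) Sc → contradiction Sc ¬Sx
    c (there c∈xs) Sc → a-max c c∈xs Sc)
  ... | yes Sx | inj₁ none = inj₂ (x , Sx , λ where
    c (here refl) _ → ≤-refl
    c (there c∈xs) Sc → contradiction Sc (none c c∈xs))
  ... | yes Sx | inj₂ (a , Sa , a-max) with total (F x) (F a)
  ...   | inj₁ Fx≤Fa = inj₂ (a , Sa , λ where
    c (here refl) _ → Fx≤Fa
    c (there c∈xs) Sc → a-max c c∈xs Sc)
  ...   | inj₂ Fa≤Fx = inj₂ (x , Sx , λ where
    c (here refl) _ → ≤-refl
    c (there c∈xs) Sc → ≤-trans (a-max c c∈xs Sc) Fa≤Fx)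

vectors : ∀ {A : Set} → List A → ∀ k → List (Vec A k)
vectors xs ℕ.zero    = [] ∷ []
vectors xs (ℕ.suc k) = cartesianProductWith _∷_ xs (vectors xs k)

vectors-complete : ∀ {A : Set} {xs : List A} → (∀ x → x ∈ xs) → ∀ k (v : Vec A k) → v ∈ vectors xs k
vectors-complete complete ℕ.zero    []       = here refl
vectors-complete complete (ℕ.suc k) (x ∷ v) =
  ∈-cartesianProductWith⁺ _∷_ (complete x) (vectors-complete complete k v)

booleans : List Bool
booleans = true ∷ false ∷ []

booleans-complete : ∀ b → b ∈ booleans
booleans-complete true  = here refl
booleans-complete false = there (here refl)

lookup²∘tabulate² : ∀ {A : Set} {k} (f : Fin k → Fin k → A) a c →
                    lookup (lookup (tabulate (λ a → tabulate (f a))) a) c ≡ f a c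
lookup²∘tabulate² f a c =
  ≡.trans (≡.cong (λ row → lookup row c) (lookup∘tabulate _ a)) (lookup∘tabulate (f a) c)

record Enumeration {n : ℕ} (P : Fin n → Bool) : Set where
  field
    size      : ℕ
    index     : Fin size → Fin n
    injective : Injective _≡_ _≡_ index
    sound     : ∀ w → T (P (index w))
    complete  : ∀ a → T (P a) → ∃ λ w → index w ≡ a

enumerate : ∀ {n} (P : Fin n → Bool) → Enumeration P
enumerate {ℕ.zero} P = record
  { size = 0 ; index = λ () ; injective = λ {} ; sound = λ () ; complete = λ () }
enumerate {ℕ.suc n} P with P zero in P₀ | enumerate (P ∘ suc)
... | true | e = record
  { size = ℕ.suc size ; index = index′ ; injective = injective′ ; sound = sound′ ; complete = complete′ }
  where
  open Enumeration e
  index′ : Fin (ℕ.suc size) → Fin (ℕ.suc n)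
  index′ zero    = zero
  index′ (suc w) = suc (index w)
  injective′ : Injective _≡_ _≡_ index′
  injective′ {zero}  {zero}  _ = refl
  injective′ {suc v} {suc w} e = ≡.cong suc (injective (suc-injective e))
  sound′ : ∀ w → T (P (index′ w))
  sound′ zero    = ≡.subst T (≡.sym P₀) tt
  sound′ (suc w) = sound w
  complete′ : ∀ a → T (P a) → ∃ λ w → index′ w ≡ a
  complete′ zero    _   = zero , refl
  complete′ (suc a) Pa  = let w , iw≡a = complete a Pa in suc w , ≡.cong suc iw≡a
... | false | e = record
  { size = size ; index = suc ∘ index ; injective = injective ∘ suc-injective
  ; sound = sound ; complete = complete′ }
  where
  open Enumeration e
  complete′ : ∀ a → T (P a) → ∃ λ w → suc (index w) ≡ a
  complete′ zero    P0  = contradiction (≡.subst T P₀ P0) λ ()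
  complete′ (suc a) Pa  = let w , iw≡a = complete a Pa in w , ≡.cong suc iw≡a

module _ {ΣV ΣE : Set} where
  open Graph

  ≅-refl : ∀ {g : Graph ΣV ΣE} → g ≅ g
  ≅-refl = ↔-id _ , (λ _ → refl) , (λ _ _ → refl)

  ≅-sym : ∀ {g₁ g₂ : Graph ΣV ΣE} → g₁ ≅ g₂ → g₂ ≅ g₁
  ≅-sym {g₁} {g₂} (φ , φ-label , φ-edge) = ↔-sym φ , label , edges
    where
    open Inverse φ
    label : ∀ v → ℓV g₁ (from v) ≡ ℓV g₂ v
    label v = ≡.trans (≡.sym (φ-label (from v))) (≡.cong (ℓV g₂) (strictlyInverseˡ v))
    edges : ∀ u v → edge g₁ (from u) (from v) ≡ edge g₂ u v
    edges u v = ≡.trans (≡.sym (φ-edge (from u) (from v)))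
                        (≡.cong₂ (edge g₂) (strictlyInverseˡ u) (strictlyInverseˡ v))

  ≅-trans : ∀ {g₁ g₂ g₃ : Graph ΣV ΣE} → g₁ ≅ g₂ → g₂ ≅ g₃ → g₁ ≅ g₃
  ≅-trans (φ , φ-label , φ-edge) (ψ , ψ-label , ψ-edge) =
    ψ ↔-∘ φ , (λ v → ≡.trans (ψ-label _) (φ-label v)) , (λ u v → ≡.trans (ψ-edge _ _) (φ-edge u v))

  ≅⇒⊆ : ∀ {g₁ g₂ : Graph ΣV ΣE} → g₁ ≅ g₂ → g₁ ⊆ g₂
  ≅⇒⊆ (φ , φ-label , φ-edge) = ↔⇒↣ φ , φ-label , (λ u v l e → ≡.trans (φ-edge u v) e)

  ⊆-trans : ∀ {g₁ g₂ g₃ : Graph ΣV ΣE} → g₁ ⊆ g₂ → g₂ ⊆ g₃ → g₁ ⊆ g₃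
  ⊆-trans (φ , φ-label , φ-edge) (ψ , ψ-label , ψ-edge) =
    ψ ↣-∘ φ , (λ v → ≡.trans (ψ-label _) (φ-label v)) , (λ u v l e → ψ-edge _ _ l (φ-edge u v l e))

  ∅ : Graph ΣV ΣE
  ∅ = record { n = 0 ; ℓV = λ () ; edge = λ () ; sym = λ () ; irrefl = λ () }

  ∅-⊆ : ∀ g → ∅ ⊆ g
  ∅-⊆ g = record { to = λ () ; cong = λ {} ; injective = λ {} } , (λ ()) , (λ ())

  module Embedding {g′ g : Graph ΣV ΣE} (φ : g′ ⊆ g) where

    embed : Fin (n g′) → Fin (n g)
    embed = Injection.to (proj₁ φ)

    embed-injective : Injective _≡_ _≡_ embed
    embed-injective = Injection.injective (proj₁ φ)

    embed-label : ∀ v → ℓV g (embed v) ≡ ℓV g′ v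
    embed-label = proj₁ (proj₂ φ)

    embed-edge : ∀ u v l → edge g′ u v ≡ just l → edge g (embed u) (embed v) ≡ just l
    embed-edge = proj₂ (proj₂ φ)

    Image : Fin (n g) → Set
    Image a = ∃ λ u → embed u ≡ a

    EdgeImage : Fin (n g) → Fin (n g) → Set
    EdgeImage a c = ∃₂ λ u v → embed u ≡ a × embed v ≡ c × ∃ λ l → edge g′ u v ≡ just l

    EdgeImage-sym : ∀ {a c} → EdgeImage a c → EdgeImage c a
    EdgeImage-sym (u , v , u↦a , v↦c , l , uv≡l) = v , u , v↦c , u↦a , l , ≡.trans (sym g′ v u) uv≡l

    EdgeImage⇒Image : ∀ {a c} → EdgeImage a c → Image a
    EdgeImage⇒Image (u , _ , u↦a , _) = u , u↦a

    EdgeImage⇒edge : ∀ {a c} → EdgeImage a c → ∃ λ l → edge g a c ≡ just l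
    EdgeImage⇒edge (u , v , refl , refl , l , uv≡l) = l , embed-edge u v l uv≡l

    EdgeImage-embed⇒edge : ∀ {u v} → EdgeImage (embed u) (embed v) → ∃ λ l → edge g′ u v ≡ just l
    EdgeImage-embed⇒edge (u′ , v′ , u′↦u , v′↦v , l , u′v′≡l) =
      l , ≡.subst₂ (λ x y → edge g′ x y ≡ just l) (embed-injective u′↦u) (embed-injective v′↦v) u′v′≡l

  module _ (g : Graph ΣV ΣE) (P : Fin (n g) → Bool) (Q : Fin (n g) → Fin (n g) → Bool) where

    private
      module P = Enumeration (enumerate P)

    -- Q need not be symmetric: an edge {a, c} survives when both Q a c and Q c a hold.
    restrictedEdge : Fin (n g) → Fin (n g) → Maybe ΣE
    restrictedEdge a c = if Q a c ∧ Q c a then edge g a c else nothing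

    restrict : Graph ΣV ΣE
    restrict = record
      { n      = P.size
      ; ℓV     = ℓV g ∘ P.index
      ; edge   = λ w w′ → restrictedEdge (P.index w) (P.index w′)
      ; sym    = λ w w′ → restrictedEdge-sym (P.index w) (P.index w′)
      ; irrefl = λ w → restrictedEdge-irrefl (P.index w)
      }
      where
      restrictedEdge-sym : ∀ a c → restrictedEdge a c ≡ restrictedEdge c a
      restrictedEdge-sym a c rewrite ∧-comm (Q a c) (Q c a) | sym g a c = refl
      restrictedEdge-irrefl : ∀ a → restrictedEdge a a ≡ nothing
      restrictedEdge-irrefl a with Q a a ∧ Q a a
      ... | true  = irrefl g a
      ... | false = refl

    restrictedEdge-just : ∀ {a c l} → T (Q a c) → T (Q c a) → edge g a c ≡ just l →
                          restrictedEdge a c ≡ just l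
    restrictedEdge-just {a} {c} Qac Qca ac≡l with Q a c ∧ Q c a | Equivalence.from T-∧ (Qac , Qca)
    ... | true | _ = ac≡l

    restrictedEdge-just⁻¹ : ∀ {a c l} → restrictedEdge a c ≡ just l → T (Q a c) × edge g a c ≡ just l
    restrictedEdge-just⁻¹ {a} {c} e with Q a c | Q c a
    ... | true | true  = tt , e
    ... | true | false = contradiction e λ ()
    ... | false | _    = contradiction e λ ()

    restrict-⊆ : restrict ⊆ g
    restrict-⊆ = record { to = P.index ; cong = ≡.cong P.index ; injective = P.injective } ,
                 (λ _ → refl) , (λ w w′ l e → proj₂ (restrictedEdge-just⁻¹ e))

    private
      module ι = Embedding {restrict} {g} restrict-⊆

    restrict-Image : ∀ {a} → T (P a) → ι.Image a
    restrict-Image = P.complete _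

    restrict-EdgeImage : ∀ {a c l} → T (P a) → T (P c) → T (Q a c) → T (Q c a) → edge g a c ≡ just l →
                         ι.EdgeImage a c
    restrict-EdgeImage {a} {c} {l} Pa Pc Qac Qca ac≡l with P.complete a Pa | P.complete c Pc
    ... | w , refl | w′ , refl = w , w′ , refl , refl , l , restrictedEdge-just Qac Qca ac≡l

    module _ {g′ : Graph ΣV ΣE} (ψ : g′ ⊆ g) where
      open Embedding {g′} {g} ψ

      restrict-⊆-image : (∀ a → T (P a) → Image a) → (∀ a c → T (Q a c) → EdgeImage a c) → restrict ⊆ g′
      restrict-⊆-image P⇒Image Q⇒EdgeImage =
        record { to = preimage ; cong = ≡.cong preimage ; injective = preimage-injective } ,
        label , edges
        where
        preimage : Fin P.size → Fin (n g′)
        preimage w = proj₁ (P⇒Image (P.index w) (P.sound w))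
        embed-preimage : ∀ w → embed (preimage w) ≡ P.index w
        embed-preimage w = proj₂ (P⇒Image (P.index w) (P.sound w))
        preimage-injective : Injective _≡_ _≡_ preimage
        preimage-injective {w} {w′} e =
          P.injective (≡.trans (≡.sym (embed-preimage w)) (≡.trans (≡.cong embed e) (embed-preimage w′)))
        label : ∀ w → ℓV g′ (preimage w) ≡ ℓV g (P.index w)
        label w = ≡.trans (≡.sym (embed-label (preimage w))) (≡.cong (ℓV g) (embed-preimage w))
        edges : ∀ w w′ l → restrictedEdge (P.index w) (P.index w′) ≡ just l →
                edge g′ (preimage w) (preimage w′) ≡ just l
        edges w w′ l e with restrictedEdge-just⁻¹ e
        ... | Qac , ac≡l with Q⇒EdgeImage _ _ Qac
        ... | u , v , u↦a , v↦c , l′ , uv≡l′ =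
          ≡.subst₂ (λ x y → edge g′ x y ≡ just l)
                   (embed-injective (≡.trans u↦a (≡.sym (embed-preimage w))))
                   (embed-injective (≡.trans v↦c (≡.sym (embed-preimage w′))))
                   (≡.trans uv≡l′ (≡.cong just l′≡l))
          where
          l′≡l : l′ ≡ l
          l′≡l = just-injective (≡.trans (≡.sym (embed-edge u v l′ uv≡l′))
                                         (≡.trans (≡.cong₂ (edge g) u↦a v↦c) ac≡l))

      ⊆-restrict : (∀ a → Image a → T (P a)) → (∀ a c → EdgeImage a c → T (Q a c)) → g′ ⊆ restrict
      ⊆-restrict Image⇒P EdgeImage⇒Q =
        record { to = position ; cong = ≡.cong position ; injective = position-injective } ,
        label , edges
        where
        position : Fin (n g′) → Fin P.size
        position u = proj₁ (P.complete (embed u) (Image⇒P _ (u , refl)))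
        index-position : ∀ u → P.index (position u) ≡ embed u
        index-position u = proj₂ (P.complete (embed u) (Image⇒P _ (u , refl)))
        position-injective : Injective _≡_ _≡_ position
        position-injective {u} {v} e = embed-injective
          (≡.trans (≡.sym (index-position u)) (≡.trans (≡.cong P.index e) (index-position v)))
        label : ∀ u → ℓV g (P.index (position u)) ≡ ℓV g′ u
        label u = ≡.trans (≡.cong (ℓV g) (index-position u)) (embed-label u)
        edges : ∀ u v l → edge g′ u v ≡ just l →
                restrictedEdge (P.index (position u)) (P.index (position v)) ≡ just l
        edges u v l uv≡l = ≡.trans (≡.cong₂ restrictedEdge (index-position u) (index-position v))
          (restrictedEdge-just (EdgeImage⇒Q _ _ uv-image) (EdgeImage⇒Q _ _ (EdgeImage-sym uv-image))
                               (embed-edge u v l uv≡l))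
          where
          uv-image : EdgeImage (embed u) (embed v)
          uv-image = u , v , refl , refl , l , uv≡l

module Sizes (em : ExcludedMiddle 0ℓ) (R : CompleteOrderedField) {ΣV ΣE : Set}
             (α : ΣV ⊎ ΣE → CompleteOrderedField.Carrier R)
             (α-positive : ∀ a → CompleteOrderedField._<_ R (CompleteOrderedField.0# R) (α a)) where
  open CompleteOrderedField R
  open OrderedFieldProperties R
  open Graph

  size : Graph ΣV ΣE → Carrier
  size = sizeGVE R α

  vertexWeight : (g : Graph ΣV ΣE) → Fin (n g) → Carrier
  vertexWeight g v = α (inj₁ (ℓV g v))

  pairWeight : (g : Graph ΣV ΣE) → Fin (n g) → Fin (n g) → Carrier
  pairWeight g u v = edgeWeight R α (edge g u v)

  vertexWeight-nonneg : ∀ g v → 0# ≤ vertexWeight g v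
  vertexWeight-nonneg g v = proj₁ (α-positive _)

  pairWeight-nonneg : ∀ g u v → 0# ≤ pairWeight g u v
  pairWeight-nonneg g u v with edge g u v
  ... | nothing = ≤-refl
  ... | just l  = proj₁ (α-positive _)

  pairWeight-positive : ∀ g {u v l} → edge g u v ≡ just l → 0# < pairWeight g u v
  pairWeight-positive g uv≡l rewrite uv≡l = α-positive _

  halfEdgeWeight : Graph ΣV ΣE → Carrier
  halfEdgeWeight g = sum (λ u → sum (λ v → select (u <? v) (pairWeight g u v)))

  size-unfold : ∀ g → size g ≈ (sum (vertexWeight g) + halfEdgeWeight g)
  size-unfold record { n = ℕ.zero }  = ≈-sym (+-identityˡ 0#)
  size-unfold g@record { n = ℕ.suc k } = ≈-reflexive (≡.cong₂ _+_
    (sumFin≡sum _ (vertexWeight g))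
    (≡.trans (sumFin≡sum _ (λ u → sumFin _ (forward u))) (sum-cong-≗ (λ u → sumFin≡sum _ (forward u)))))
    where
    forward : Fin (ℕ.suc k) → Fin (ℕ.suc k) → Carrier
    forward u v = select (u <? v) (pairWeight g u v)

  pairWeight-split : ∀ g u v →
    pairWeight g u v ≈ (select (u <? v) (pairWeight g u v) + select (v <? u) (pairWeight g u v))
  pairWeight-split g u v with <-cmp u v
  ... | tri< u<v _ v≮u = ≈-sym (≈-trans
    (+-cong (select-yes (u <? v) u<v _) (select-no (v <? u) v≮u _)) (+-identityʳ _))
  ... | tri> u≮v _ v<u = ≈-sym (≈-trans
    (+-cong (select-no (u <? v) u≮v _) (select-yes (v <? u) v<u _)) (+-identityˡ _))
  ... | tri≈ u≮u refl _ = ≈-trans (≈-reflexive (≡.cong (edgeWeight R α) (irrefl g u))) (≈-sym (≈-trans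
    (+-cong (select-no (u <? u) u≮u _) (select-no (u <? u) u≮u _)) (+-identityˡ 0#)))

  sum²-pairWeight≈ : ∀ g → sum² (pairWeight g) ≈ (halfEdgeWeight g + halfEdgeWeight g)
  sum²-pairWeight≈ g = begin-equality
    sum (λ u → sum (pairWeight g u))
      ≈⟨ sum-cong-≋ (sum-cong-≋ ∘ pairWeight-split g) ⟩
    sum (λ u → sum (λ v → forward u v + backward u v))
      ≈⟨ sum-cong-≋ (λ u → ∑-distrib-+ (forward u) (backward u)) ⟩
    sum (λ u → sum (forward u) + sum (backward u))
      ≈⟨ ∑-distrib-+ (sum ∘ forward) (sum ∘ backward) ⟩
    halfEdgeWeight g + sum (λ u → sum (backward u))
      ≈⟨ +-congˡ (∑-comm backward) ⟩
    halfEdgeWeight g + sum (λ v → sum (λ u → backward u v))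
      ≈⟨ +-congˡ (sum-cong-≋ λ v → sum-cong-≋ λ u →
           ≈-reflexive (≡.cong (select (v <? u) ∘ edgeWeight R α) (sym g u v))) ⟩
    halfEdgeWeight g + halfEdgeWeight g
      ∎
    where
    forward backward : Fin (n g) → Fin (n g) → Carrier
    forward  u v = select (u <? v) (pairWeight g u v)
    backward u v = select (v <? u) (pairWeight g u v)

  weight₂ : ∀ {k} → (Fin k → Carrier) → (Fin k → Fin k → Carrier) → Carrier
  weight₂ f e = (sum f + sum f) + sum² e

  size₂ : Graph ΣV ΣE → Carrier
  size₂ g = weight₂ (vertexWeight g) (pairWeight g)

  size+size≈size₂ : ∀ g → (size g + size g) ≈ size₂ g
  size+size≈size₂ g = begin-equality
    size g + size g                      ≈⟨ +-cong (size-unfold g) (size-unfold g) ⟩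
    (V + H) + (V + H)                    ≈⟨ interchange V H V H ⟩
    (V + V) + (H + H)                    ≈⟨ +-congˡ (sum²-pairWeight≈ g) ⟨
    (V + V) + sum² (pairWeight g)        ∎
    where
    V H : Carrier
    V = sum (vertexWeight g)
    H = halfEdgeWeight g

  module _ {k : ℕ} where

    weight₂-mono-≤ : ∀ {f f′ : Fin k → Carrier} {e e′ : Fin k → Fin k → Carrier} →
                     (∀ a → f a ≤ f′ a) → (∀ a c → e a c ≤ e′ a c) → weight₂ f e ≤ weight₂ f′ e′
    weight₂-mono-≤ f≤f′ e≤e′ =
      +-mono-≤ (+-mono-≤ (sum-mono-≤ f≤f′) (sum-mono-≤ f≤f′)) (sum-mono-≤ (sum-mono-≤ ∘ e≤e′))

    weight₂-mono-≤-tight : ∀ {f f′ : Fin k → Carrier} {e e′ : Fin k → Fin k → Carrier} →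
                           (∀ a → f a ≤ f′ a) → (∀ a c → e a c ≤ e′ a c) → weight₂ f′ e′ ≤ weight₂ f e →
                           (∀ a → f′ a ≤ f a) × (∀ a c → e′ a c ≤ e a c)
    weight₂-mono-≤-tight f≤f′ e≤e′ w′≤w
      with +-mono-≤-tight (+-mono-≤ (sum-mono-≤ f≤f′) (sum-mono-≤ f≤f′))
                          (sum-mono-≤ (sum-mono-≤ ∘ e≤e′)) w′≤w
    ... | V′+V′≤V+V , E′≤E =
      sum-mono-≤-tight f≤f′ (x+x≤y+y⇒x≤y V′+V′≤V+V) ,
      λ a → sum-mono-≤-tight (e≤e′ a) (sum-mono-≤-tight (sum-mono-≤ ∘ e≤e′) E′≤E a)

    weight₂-inclusion–exclusion :
      ∀ {f₁ f₂ f f₃ : Fin k → Carrier} {e₁ e₂ e e₃ : Fin k → Fin k → Carrier} →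
      (∀ a → (f₁ a + f₂ a) ≤ (f a + f₃ a)) → (∀ a c → (e₁ a c + e₂ a c) ≤ (e a c + e₃ a c)) →
      (weight₂ f₁ e₁ + weight₂ f₂ e₂) ≤ (weight₂ f e + weight₂ f₃ e₃)
    weight₂-inclusion–exclusion {f₁} {f₂} {f} {f₃} {e₁} {e₂} {e} {e₃} f-ie e-ie = begin
      weight₂ f₁ e₁ + weight₂ f₂ e₂
        ≈⟨ shuffle (sum f₁) (sum f₂) (sum² e₁) (sum² e₂) ⟩
      ((sum f₁ + sum f₂) + (sum f₁ + sum f₂)) + (sum² e₁ + sum² e₂)
        ≤⟨ +-mono-≤ (+-mono-≤ (sum-+-mono-≤ f-ie) (sum-+-mono-≤ f-ie)) (sum²-+-mono-≤ e-ie) ⟩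
      ((sum f + sum f₃) + (sum f + sum f₃)) + (sum² e + sum² e₃)
        ≈⟨ shuffle (sum f) (sum f₃) (sum² e) (sum² e₃) ⟨
      weight₂ f e + weight₂ f₃ e₃
        ∎
      where
      shuffle : ∀ x y u v → (((x + x) + u) + ((y + y) + v)) ≈ (((x + y) + (x + y)) + (u + v))
      shuffle x y u v = ≈-trans (interchange (x + x) u (y + y) v) (+-cong (interchange x x y y) ≈-refl)

  when : Set → Carrier → Carrier
  when A = select (em {A})

  module EmbeddingWeights {g′ g : Graph ΣV ΣE} (φ : g′ ⊆ g) where
    open Embedding {g′ = g′} {g = g} φ

    imageVertexWeight : Fin (n g) → Carrier
    imageVertexWeight a = when (Image a) (vertexWeight g a)

    imagePairWeight : Fin (n g) → Fin (n g) → Carrier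
    imagePairWeight a c = when (EdgeImage a c) (pairWeight g a c)

    vertexWeight-embed : ∀ u → vertexWeight g′ u ≈ imageVertexWeight (embed u)
    vertexWeight-embed u = ≈-sym (≈-trans (select-yes em (u , refl) _)
                                          (≈-reflexive (≡.cong (α ∘ inj₁) (embed-label u))))

    pairWeight-embed : ∀ u v → pairWeight g′ u v ≈ imagePairWeight (embed u) (embed v)
    pairWeight-embed u v with edge g′ u v in uv≡
    ... | just l  = ≈-sym (≈-trans (select-yes em (u , v , refl , refl , l , uv≡) _)
                                   (≈-reflexive (≡.cong (edgeWeight R α) (embed-edge u v l uv≡))))
    ... | nothing = ≈-sym (select-no em no-edge _)
      where
      no-edge : ¬ EdgeImage (embed u) (embed v)
      no-edge uv-image with EdgeImage-embed⇒edge uv-image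
      ... | l , uv≡l = contradiction (≡.trans (≡.sym uv≡) uv≡l) λ ()

    imageWeight₂ : Carrier
    imageWeight₂ = weight₂ imageVertexWeight imagePairWeight

    size₂≈imageWeight₂ : size₂ g′ ≈ imageWeight₂
    size₂≈imageWeight₂ = +-cong (+-cong vertices vertices) edges
      where
      vertices : sum (vertexWeight g′) ≈ sum imageVertexWeight
      vertices = begin-equality
        sum (vertexWeight g′)              ≈⟨ sum-cong-≋ vertexWeight-embed ⟩
        sum (imageVertexWeight ∘ embed)    ≈⟨ sum-∘-injective embed-injective imageVertexWeight
                                                (λ a ∄u → select-no em (λ (u , u↦a) → ∄u u u↦a) _) ⟩
        sum imageVertexWeight              ∎
      edges : sum² (pairWeight g′) ≈ sum² imagePairWeight
      edges = begin-equality
        sum (λ u → sum (pairWeight g′ u))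
          ≈⟨ sum-cong-≋ (sum-cong-≋ ∘ pairWeight-embed) ⟩
        sum (λ u → sum (λ v → imagePairWeight (embed u) (embed v)))
          ≈⟨ sum-cong-≋ (λ u → sum-∘-injective embed-injective (imagePairWeight (embed u))
               (λ c ∄v → select-no em (λ E → ∄v _ (proj₂ (EdgeImage⇒Image (EdgeImage-sym E)))) _)) ⟩
        sum (λ u → sum (imagePairWeight (embed u)))
          ≈⟨ sum-∘-injective embed-injective (sum ∘ imagePairWeight)
               (λ a ∄u → sum-zero {f = imagePairWeight a}
                           (λ c → select-no em (λ E → ∄u _ (proj₂ (EdgeImage⇒Image E))) _)) ⟩
        sum (λ a → sum (imagePairWeight a))
          ∎

    imageWeight₂≤size₂ : imageWeight₂ ≤ size₂ g
    imageWeight₂≤size₂ = weight₂-mono-≤ (λ a → select-≤ em (vertexWeight-nonneg g a))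
                                        (λ a c → select-≤ em (pairWeight-nonneg g a c))

    size₂≤⇒onto : size₂ g ≤ size₂ g′ →
                  (∀ a → Image a) × (∀ a c l → edge g a c ≡ just l → EdgeImage a c)
    size₂≤⇒onto g≤g′
      with weight₂-mono-≤-tight (λ a → select-≤ em (vertexWeight-nonneg g a))
                                (λ a c → select-≤ em (pairWeight-nonneg g a c))
                                (≤-trans g≤g′ (≤-reflexive size₂≈imageWeight₂))
    ... | vertex≤ , pair≤ =
      (λ a → select-positive em (α-positive _) (vertex≤ a)) ,
      (λ a c l ac≡l → select-positive em (pairWeight-positive g ac≡l) (pair≤ a c))

  size₂-mono-≤ : ∀ {g′ g} → g′ ⊆ g → size₂ g′ ≤ size₂ g
  size₂-mono-≤ {g′} {g} φ = ≤-trans (≤-reflexive size₂≈imageWeight₂) imageWeight₂≤size₂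
    where open EmbeddingWeights {g′} {g} φ

  size-mono-≤ : ∀ {g′ g} → g′ ⊆ g → size g′ ≤ size g
  size-mono-≤ {g′} {g} φ = x+x≤y+y⇒x≤y (begin
    size g′ + size g′  ≈⟨ size+size≈size₂ g′ ⟩
    size₂ g′           ≤⟨ size₂-mono-≤ {g′} {g} φ ⟩
    size₂ g            ≈⟨ size+size≈size₂ g ⟨
    size g + size g    ∎)

  size-nonneg : ∀ g → 0# ≤ size g
  size-nonneg g = size-mono-≤ {∅} {g} (∅-⊆ g)

  size-cong : ∀ {g₁ g₂} → g₁ ≅ g₂ → size g₁ ≈ size g₂
  size-cong {g₁} {g₂} g₁≅g₂ =
    antisym (size-mono-≤ {g₁} {g₂} (≅⇒⊆ {g₁ = g₁} {g₂} g₁≅g₂))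
            (size-mono-≤ {g₂} {g₁} (≅⇒⊆ {g₁ = g₂} {g₁} (≅-sym {g₁ = g₁} {g₂} g₁≅g₂)))

  size-≈⇒≅ : ∀ {g′ g} → g′ ⊆ g → size g′ ≈ size g → g′ ≅ g
  size-≈⇒≅ {g′} {g} φ g′≈g = mk↔ₛ′ embed preimage embed-preimage preimage-embed , embed-label , edges
    where
    open Embedding {g′ = g′} {g = g} φ
    open EmbeddingWeights {g′} {g} φ using (size₂≤⇒onto)
    onto : (∀ a → Image a) × (∀ a c l → edge g a c ≡ just l → EdgeImage a c)
    onto = size₂≤⇒onto (begin
      size₂ g             ≈⟨ size+size≈size₂ g ⟨
      size g + size g     ≈⟨ +-cong g′≈g g′≈g ⟨
      size g′ + size g′   ≈⟨ size+size≈size₂ g′ ⟩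
      size₂ g′            ∎)
    preimage : Fin (n g) → Fin (n g′)
    preimage a = proj₁ (proj₁ onto a)
    embed-preimage : ∀ a → embed (preimage a) ≡ a
    embed-preimage a = proj₂ (proj₁ onto a)
    preimage-embed : ∀ u → preimage (embed u) ≡ u
    preimage-embed u = embed-injective (embed-preimage (embed u))
    edges : ∀ u v → edge g (embed u) (embed v) ≡ edge g′ u v
    edges u v with edge g′ u v in uv≡
    ... | just l = embed-edge u v l uv≡
    ... | nothing with edge g (embed u) (embed v) in euv≡
    ...   | nothing = refl
    ...   | just l with EdgeImage-embed⇒edge (proj₂ onto _ _ l euv≡)
    ...     | _ , uv≡l′ = contradiction (≡.trans (≡.sym uv≡) uv≡l′) λ ()

  size₂-+-≤⇒size-−-≤ : ∀ {g₁ g₂ g g₁₂} → (size₂ g₁ + size₂ g₂) ≤ (size₂ g + size₂ g₁₂) →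
                        ((size g₁ + size g₂) − size g₁₂) ≤ size g
  size₂-+-≤⇒size-−-≤ {g₁} {g₂} {g} {g₁₂} ≤₂ = x≤z+y⇒x−y≤z (x+x≤y+y⇒x≤y (begin
    (size g₁ + size g₂) + (size g₁ + size g₂)    ≈⟨ interchange _ _ _ _ ⟩
    (size g₁ + size g₁) + (size g₂ + size g₂)    ≈⟨ +-cong (size+size≈size₂ g₁) (size+size≈size₂ g₂) ⟩
    size₂ g₁ + size₂ g₂                          ≤⟨ ≤₂ ⟩
    size₂ g + size₂ g₁₂                          ≈⟨ +-cong (size+size≈size₂ g) (size+size≈size₂ g₁₂) ⟨
    (size g + size g) + (size g₁₂ + size g₁₂)    ≈⟨ interchange _ _ _ _ ⟩
    (size g + size g₁₂) + (size g + size g₁₂)    ∎))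

  module Intersection {x₁ x₂ x : Graph ΣV ΣE} (φ₁ : x₁ ⊆ x) (φ₂ : x₂ ⊆ x) where
    private
      module φ₁ = Embedding {g′ = x₁} {g = x} φ₁
      module φ₂ = Embedding {g′ = x₂} {g = x} φ₂
      module W₁ = EmbeddingWeights {x₁} {x} φ₁
      module W₂ = EmbeddingWeights {x₂} {x} φ₂

    sharedVertex : Fin (n x) → Bool
    sharedVertex a = isYes (em {φ₁.Image a × φ₂.Image a})

    sharedEdge : Fin (n x) → Fin (n x) → Bool
    sharedEdge a c = isYes (em {φ₁.EdgeImage a c × φ₂.EdgeImage a c})

    intersection : Graph ΣV ΣE
    intersection = restrict x sharedVertex sharedEdge

    intersection-⊆₁ : intersection ⊆ x₁
    intersection-⊆₁ = restrict-⊆-image x sharedVertex sharedEdge {x₁} φ₁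
      (λ _ shared → proj₁ (toWitness shared)) (λ _ _ shared → proj₁ (toWitness shared))

    intersection-⊆₂ : intersection ⊆ x₂
    intersection-⊆₂ = restrict-⊆-image x sharedVertex sharedEdge {x₂} φ₂
      (λ _ shared → proj₂ (toWitness shared)) (λ _ _ shared → proj₂ (toWitness shared))

    private
      ι : intersection ⊆ x
      ι = restrict-⊆ x sharedVertex sharedEdge
      module W = EmbeddingWeights {intersection} {x} ι

    size-intersection : ((size x₁ + size x₂) − size intersection) ≤ size x
    size-intersection = size₂-+-≤⇒size-−-≤ {x₁} {x₂} {x} {intersection} (begin
      size₂ x₁ + size₂ x₂              ≈⟨ +-cong W₁.size₂≈imageWeight₂ W₂.size₂≈imageWeight₂ ⟩
      W₁.imageWeight₂ + W₂.imageWeight₂ ≤⟨ weight₂-inclusion–exclusion vertices edges ⟩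
      size₂ x + W.imageWeight₂          ≈⟨ +-congˡ W.size₂≈imageWeight₂ ⟨
      size₂ x + size₂ intersection      ∎)
      where
      vertices : ∀ a → (W₁.imageVertexWeight a + W₂.imageVertexWeight a) ≤
                       (vertexWeight x a + W.imageVertexWeight a)
      vertices a = select-inclusion–exclusion em em em
        (λ I₁ I₂ → restrict-Image x sharedVertex sharedEdge (fromWitness (I₁ , I₂)))
        (vertexWeight-nonneg x a)
      edges : ∀ a c → (W₁.imagePairWeight a c + W₂.imagePairWeight a c) ≤
                      (pairWeight x a c + W.imagePairWeight a c)
      edges a c = select-inclusion–exclusion em em em
        (λ E₁ E₂ → restrict-EdgeImage x sharedVertex sharedEdge
          (fromWitness (φ₁.EdgeImage⇒Image E₁ , φ₂.EdgeImage⇒Image E₂))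
          (fromWitness (φ₁.EdgeImage⇒Image (φ₁.EdgeImage-sym E₁) ,
                        φ₂.EdgeImage⇒Image (φ₂.EdgeImage-sym E₂)))
          (fromWitness (E₁ , E₂))
          (fromWitness (φ₁.EdgeImage-sym E₁ , φ₂.EdgeImage-sym E₂))
          (proj₂ (φ₁.EdgeImage⇒edge E₁)))
        (pairWeight-nonneg x a c)

  module GreatestCommonPart (x₁ x₂ : Graph ΣV ΣE) where

    Selection : Set
    Selection = Vec Bool (n x₁) × Vec (Vec Bool (n x₁)) (n x₁)

    selections : List Selection
    selections = cartesianProduct (vectors booleans _) (vectors (vectors booleans _) _)

    selections-complete : ∀ s → s ∈ selections
    selections-complete (vs , es) = ∈-cartesianProduct⁺
      (vectors-complete booleans-complete _ vs)
      (vectors-complete (vectors-complete booleans-complete _) _ es)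

    selectsVertex : Selection → Fin (n x₁) → Bool
    selectsVertex (vs , _) = lookup vs

    selectsEdge : Selection → Fin (n x₁) → Fin (n x₁) → Bool
    selectsEdge (_ , es) a c = lookup (lookup es a) c

    candidate : Selection → Graph ΣV ΣE
    candidate s = restrict x₁ (selectsVertex s) (selectsEdge s)

    module _ (y : Graph ΣV ΣE) (p : y ⊆ x₁) where
      open Embedding {g′ = y} {g = x₁} p

      selectionOf : Selection
      selectionOf = tabulate (λ a → isYes (em {Image a})) ,
                    tabulate (λ a → tabulate (λ c → isYes (em {EdgeImage a c})))

      candidate-⊆ : candidate selectionOf ⊆ y
      candidate-⊆ = restrict-⊆-image x₁ _ _ {y} p
        (λ a s → toWitness (≡.subst T (lookup∘tabulate _ a) s))
        (λ a c s → toWitness (≡.subst T (lookup²∘tabulate² _ a c) s))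

      ⊆-candidate : y ⊆ candidate selectionOf
      ⊆-candidate = ⊆-restrict x₁ _ _ {y} p
        (λ a I → ≡.subst T (≡.sym (lookup∘tabulate _ a)) (fromWitness I))
        (λ a c E → ≡.subst T (≡.sym (lookup²∘tabulate² _ a c)) (fromWitness E))

    greatest : ∃ λ x → x ⊆ x₁ × x ⊆ x₂ × (∀ y → y ⊆ x₁ → y ⊆ x₂ → size y ≤ size x)
    greatest with argmax (λ s → em {candidate s ⊆ x₂}) (size ∘ candidate) selections
    ... | inj₁ none = contradiction
      (⊆-trans {g₁ = candidate (selectionOf ∅ (∅-⊆ x₁))} {∅} {x₂} (candidate-⊆ ∅ (∅-⊆ x₁)) (∅-⊆ x₂))
      (none (selectionOf ∅ (∅-⊆ x₁)) (selections-complete _))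
    ... | inj₂ (s , s⊆x₂ , s-max) =
      candidate s , restrict-⊆ x₁ (selectsVertex s) (selectsEdge s) , s⊆x₂ , λ y p q →
      ≤-trans (size-mono-≤ {y} {candidate (selectionOf y p)} (⊆-candidate y p))
              (s-max (selectionOf y p) (selections-complete _)
                     (⊆-trans {g₁ = candidate (selectionOf y p)} {y} {x₂} (candidate-⊆ y p) q))

  ⊆-isPartialOrder : IsPartialOrder (_≅_ {ΣV} {ΣE}) _⊆_
  ⊆-isPartialOrder = record
    { isPreorder = record
      { isEquivalence = record
        { refl  = λ {g} → ≅-refl {g = g}
        ; sym   = λ {g₁} {g₂} → ≅-sym {g₁ = g₁} {g₂}
        ; trans = λ {g₁} {g₂} {g₃} → ≅-trans {g₁ = g₁} {g₂} {g₃}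
        }
      ; reflexive = λ {g₁} {g₂} → ≅⇒⊆ {g₁ = g₁} {g₂}
      ; trans     = λ {g₁} {g₂} {g₃} → ⊆-trans {g₁ = g₁} {g₂} {g₃}
      }
    ; antisym = λ {g₁} {g₂} g₁⊆g₂ g₂⊆g₁ →
        size-≈⇒≅ g₁⊆g₂ (antisym (size-mono-≤ {g₁} {g₂} g₁⊆g₂) (size-mono-≤ {g₂} {g₁} g₂⊆g₁))
    }

  isMCSModel : MCS.IsMCSModel R (Graph ΣV ΣE) _≅_ _⊆_ size
  isMCSModel = record
    { isPartialOrder = ⊆-isPartialOrder
    ; s-cong   = λ {g₁} {g₂} → size-cong {g₁} {g₂}
    ; s-nonneg = size-nonneg
    ; S1       = λ {g₁} {g₂} → size-mono-≤ {g₁} {g₂}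
    ; S2       = λ {g₁} {g₂} → size-≈⇒≅ {g₁} {g₂}
    ; A1       = λ x₁ x₂ → GreatestCommonPart.greatest x₁ x₂
    ; A2       = λ x₁ x₂ x φ₁ φ₂ → let open Intersection {x₁} {x₂} {x} φ₁ φ₂ in
                   intersection , intersection-⊆₁ , intersection-⊆₂ , size-intersection
    }

theorem2 : ExcludedMiddle 0ℓ →
    (R : CompleteOrderedField) → (ΣV ΣE : Set) →
    (α : ΣV ⊎ ΣE → CompleteOrderedField.Carrier R) →
    (∀ a → CompleteOrderedField._<_ R (CompleteOrderedField.0# R) (α a)) →
    MCS.IsMCSModel R (Graph ΣV ΣE) _≅_ _⊆_ (sizeGVE R α)
theorem2 em R ΣV ΣE α α-positive = Sizes.isMCSModel em R α α-positive
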